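{- Every right-reducible TRS has UNC.
   Context: A TRS is a finite set of rewrite rules $l\to r$ ($l\notin\mathcal{V}$, $\mathcal{V}(r)\subseteq\mathcal{V}(l)$); $\mathrm{NF}(\mathcal{R})$ is its set of normal forms. $\mathcal{R}$ has UNC if $s\stackrel{*}{\leftrightarrow}_{\mathcal{R}}t$ and $s,t\in\mathrm{NF}(\mathcal{R})$ imply $s=t$. $\mathcal{R}$ is right-reducible if $r\notin\mathrm{NF}(\mathcal{R})$ for every rule $l\to r\in\mathcal{R}$. -}

module Defs where

open import Data.Nat using (ℕ; suc)
open import Data.Fin using (Fin)
open import Data.Vec using (Vec; []; _∷_; lookup; _[_]≔_)
open import Data.List using (List)
open import Data.List.Membership.Propositional using (_∈_)
open import Data.Product using (_×_; ∃; _,_)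
open import Relation.Binary.PropositionalEquality using (_≡_)
open import Relation.Nullary using (¬_)
open import Relation.Binary.Construct.Closure.ReflexiveTransitive using (Star)
open import Relation.Binary.Construct.Closure.Symmetric using (SymClosure)

record Signature : Set₁ where
  field
    Sym   : Set
    arity : Sym → ℕ

Var : Set
Var = ℕ

module _ (Σ : Signature) where
  open Signature Σ

  data Term : Set where
    var : Var → Term
    fun : (f : Sym) → Vec Term (arity f) → Term

  Subst : Set
  Subst = Var → Term

  mutual
    _⟨_⟩ : Term → Subst → Term
    var x    ⟨ σ ⟩ = σ x
    fun f ts ⟨ σ ⟩ = fun f (substs ts σ)

    substs : ∀ {n} → Vec Term n → Subst → Vec Term n
    substs []       σ = []
    substs (t ∷ ts) σ = (t ⟨ σ ⟩) ∷ substs ts σ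

  mutual
    data _∈V_ (x : Var) : Term → Set where
      here : x ∈V var x
      under : ∀ {f ts} → x ∈Vs ts → x ∈V fun f ts

    data _∈Vs_ (x : Var) : ∀ {n} → Vec Term n → Set where
      hd : ∀ {n t} {ts : Vec Term n} → x ∈V t → x ∈Vs (t ∷ ts)
      tl : ∀ {n t} {ts : Vec Term n} → x ∈Vs ts → x ∈Vs (t ∷ ts)

  IsVar : Term → Set
  IsVar t = ∃ λ x → t ≡ var x

  record Rule : Set where
    constructor _⇒_∣_∣_
    field
      lhs : Term
      rhs : Term
      lhs-nonvar : ¬ IsVar lhs
      vars-ok : ∀ x → x ∈V rhs → x ∈V lhs

  TRS : Set
  TRS = List Rule

  module _ (R : TRS) where
    data _⟶_ : Term → Term → Set where
      root : ∀ {ρ} → ρ ∈ R → (σ : Subst) →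
             (Rule.lhs ρ ⟨ σ ⟩) ⟶ (Rule.rhs ρ ⟨ σ ⟩)
      cong : ∀ {f} (ts : Vec Term (arity f)) (i : Fin (arity f)) {t'} →
             lookup ts i ⟶ t' → fun f ts ⟶ fun f (ts [ i ]≔ t')

    NF : Term → Set
    NF t = ¬ ∃ λ u → t ⟶ u

    _⟷*_ : Term → Term → Set
    _⟷*_ = Star (SymClosure _⟶_)

  UNC : TRS → Set
  UNC R = ∀ s t → NF R s → NF R t → _⟷*_ R s t → s ≡ t

  RightReducible : TRS → Set
  RightReducible R = ∀ ρ → ρ ∈ R → ¬ NF R (Rule.rhs ρ)

module Submission where

-- In a right-reducible TRS the target of every rewrite step is reducible:
-- a root step lands on an instance of a reducible right-hand side, and
-- reducibility is stable under substitution and under contexts. So no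
-- step of a conversion can start from a normal form, in either direction,
-- and a conversion between normal forms must be empty.

open import Defs
open import Data.Fin using (Fin; zero; suc)
open import Data.Vec using (Vec; []; _∷_; lookup; _[_]≔_)
open import Data.Vec.Properties using (lookup∘update)
open import Data.Product using (∃; _,_)
open import Data.Empty using (⊥-elim)
open import Relation.Nullary using (¬_)
open import Relation.Binary.PropositionalEquality using (_≡_; refl; cong₂; subst; sym)
  renaming (cong to ≡-cong)
open import Relation.Binary.Construct.Closure.ReflexiveTransitive using (ε; _◅_)
open import Relation.Binary.Construct.Closure.Symmetric using (fwd; bwd)

module _ (Σ : Signature) where
  open Signature Σ

  private
    _·_ : Term Σ → Subst Σ → Term Σ
    t · σ = _⟨_⟩ Σ t σ

  _∘ₛ_ : Subst Σ → Subst Σ → Subst Σ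
  (σ ∘ₛ τ) x = σ x · τ

  mutual
    ⟨⟩-∘ₛ : (t : Term Σ) (σ τ : Subst Σ) → (t · σ) · τ ≡ t · (σ ∘ₛ τ)
    ⟨⟩-∘ₛ (var x)    σ τ = refl
    ⟨⟩-∘ₛ (fun f ts) σ τ = ≡-cong (fun f) (substs-∘ₛ ts σ τ)

    substs-∘ₛ : ∀ {n} (ts : Vec (Term Σ) n) (σ τ : Subst Σ) →
                substs Σ (substs Σ ts σ) τ ≡ substs Σ ts (σ ∘ₛ τ)
    substs-∘ₛ []       σ τ = refl
    substs-∘ₛ (t ∷ ts) σ τ = cong₂ _∷_ (⟨⟩-∘ₛ t σ τ) (substs-∘ₛ ts σ τ)

  lookup-substs : ∀ {n} (ts : Vec (Term Σ) n) (i : Fin n) (σ : Subst Σ) →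
                  lookup (substs Σ ts σ) i ≡ lookup ts i · σ
  lookup-substs (t ∷ ts) zero    σ = refl
  lookup-substs (t ∷ ts) (suc i) σ = lookup-substs ts i σ

  module _ (R : TRS Σ) where
    private
      _⟶R_ : Term Σ → Term Σ → Set
      _⟶R_ = _⟶_ Σ R

      Reducible : Term Σ → Set
      Reducible t = ∃ λ u → t ⟶R u

    ⟶-reducible-⟨⟩ : ∀ {t u} (σ : Subst Σ) → t ⟶R u → Reducible (t · σ)
    ⟶-reducible-⟨⟩ σ (root {ρ} ρ∈R τ) =
      _ , subst (_⟶R (Rule.rhs ρ · (τ ∘ₛ σ))) (sym (⟨⟩-∘ₛ (Rule.lhs ρ) τ σ))
                (root ρ∈R (τ ∘ₛ σ))
    ⟶-reducible-⟨⟩ σ (cong ts i step) with ⟶-reducible-⟨⟩ σ step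
    ... | w , step′ =
      _ , cong (substs Σ ts σ) i (subst (_⟶R w) (sym (lookup-substs ts i σ)) step′)

    ⟶-target-reducible : RightReducible Σ R → ∀ {s t} → s ⟶R t → ¬ NF Σ R t
    ⟶-target-reducible rr (root {ρ} ρ∈R σ) nf =
      rr ρ ρ∈R λ (_ , rhs-step) → nf (⟶-reducible-⟨⟩ σ rhs-step)
    ⟶-target-reducible rr (cong ts i {t′} step) nf =
      ⟶-target-reducible rr step λ (w , step′) →
        nf (_ , cong (ts [ i ]≔ t′) i (subst (_⟶R w) (sym (lookup∘update i ts t′)) step′))

theorem7 : (Σ : Signature) (R : TRS Σ) → RightReducible Σ R → UNC Σ R
theorem7 Σ R rr s t nf-s nf-t ε              = refl
theorem7 Σ R rr s t nf-s nf-t (fwd step ◅ _) = ⊥-elim (nf-s (_ , step))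
theorem7 Σ R rr s t nf-s nf-t (bwd step ◅ _) = ⊥-elim (⟶-target-reducible Σ R rr step nf-s)
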